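{- Suppose $\alpha$ and $\beta$ are relatively prime positive integers, and $\vec q = (q_0,\dots,q_{m-1})$ is the sequence of quotients of a simple continued fraction expansion $\alpha/\beta = q_0 + \cfrac{1}{q_1 + \cfrac{1}{\ddots + \cfrac{1}{q_{m-1}}}}$ with positive integer quotients. Then $\beta$ is a root of the quadratic congruence \[ x^2 + [\vec q]^{\star}\, x + (-1)^{m} \equiv 0 \pmod{\alpha}. \]
   Context: Continuants: for a sequence of integers $q_0,\dots,q_{m-1}$ and $0\le i\le j+2\le m+1$, define $[q_i,\dots,q_j]$ recursively by $[q_i,\dots,q_{i-2}]=0$, $[q_i,\dots,q_{i-1}]=1$, and $[q_i,\dots,q_j] = q_j\,[q_i,\dots,q_{j-1}] + [q_i,\dots,q_{j-2}]$ for $j\ge i$. The anticontinuant of $\vec q$ is $[\vec q]^{\star} := [q_0,\dots,q_{m-2}] - [q_1,\dots,q_{m-1}]$. -}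

module Defs where

open import Data.Nat using (ℕ; zero; suc)
open import Data.Integer using (ℤ; +_; -[1+_]; _+_; _*_; _-_)
open import Data.List using (List; []; _∷_)
open import Data.Rational.Unnormalised using (ℚᵘ; mkℚᵘ)
import Data.Rational.Unnormalised as Q

-- Continuant [q_0,...,q_{k-1}] of a list, computed via the recursion
-- [q_i..q_j] = q_j [q_i..q_{j-1}] + [q_i..q_{j-2}], [] = 1, "[q_i..q_{i-2}]" = 0.
-- contAux prev cur rest: prev = continuant of prefix minus last, cur = of prefix.
contAux : ℤ → ℤ → List ℤ → ℤ
contAux prev cur []       = cur
contAux prev cur (q ∷ qs) = contAux cur (q * cur + prev) qs

continuant : List ℤ → ℤ
continuant qs = contAux (+ 0) (+ 1) qs

init : List ℤ → List ℤ
init []           = []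
init (x ∷ [])     = []
init (x ∷ y ∷ ys) = x ∷ init (y ∷ ys)

tail : List ℤ → List ℤ
tail []       = []
tail (x ∷ xs) = xs

anticontinuant : List ℤ → ℤ
anticontinuant qs = continuant (init qs) - continuant (tail qs)

-- reciprocal of a positive unnormalised rational (junk value 0 otherwise)
recip⁺ : ℚᵘ → ℚᵘ
recip⁺ (mkℚᵘ (+ suc n) d) = mkℚᵘ (+ suc d) n
recip⁺ _                  = Q.0ℚᵘ

-- value of the simple continued fraction q_0 + 1/(q_1 + 1/(... + 1/q_{m-1}))
-- (junk value 0 for the empty list)
cfValue : List ℤ → ℚᵘ
cfValue []           = Q.0ℚᵘ
cfValue (q ∷ [])     = q Q./ 1
cfValue (q ∷ r ∷ rs) = (q Q./ 1) Q.+ recip⁺ (cfValue (r ∷ rs))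

module Submission where

-- Write P(L) for the continuant of the quotient list L (numerator of the
-- continued fraction) and X(L) for the continuant of its tail (denominator).
-- The proof has three ingredients.
--   1. Continuants are computed by a two-term recursion from an initial pair;
--      the result is linear in that pair, which gives the expansion
--      P(q ∷ L) = q P(L) + X(L) and hence, for positive quotients, the value
--      of the continued fraction as the fraction P(L)/X(L).
--   2. The determinant of two runs of the recursion gets multiplied by -1 at
--      each step.  For the runs computing numerators and denominators this is
--        [q_0..q_{m-2}] X(L) + (-1)^m = P(L) N(L)   with N(L) = [q_1..q_{m-2}],
--      so P(L) and X(L) are coprime and P(L)/X(L) is in lowest terms.
--   3. A positive rational has a unique reduced representation, so α = P(L)
--      and β = X(L).  Since β² + [q]* β = [q_0..q_{m-2}] β, the determinant
--      identity says that β² + [q]* β + (-1)^m is the multiple P(L) N(L) of α.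

open import Defs
open import Data.Nat using (ℕ; suc)
open import Data.Integer using (ℤ; +_; -[1+_]; _+_; _-_; _*_; _^_; _<_; ∣_∣; +<+)
open import Data.Integer.Divisibility using (_∣_)
open import Data.Integer.Tactic.RingSolver using (solve-∀)
open import Data.Nat.Coprimality using (Coprime)
open import Data.List using (List; []; _∷_; length)
open import Data.List.Relation.Unary.All using (All; []; _∷_)
open import Data.Product using (Σ; _×_; _,_; proj₁; proj₂)
open import Data.Rational.Unnormalised using (_≃_; _/_; mkℚᵘ; *≡*)
open import Relation.Binary.PropositionalEquality
import Data.Nat as ℕ
import Data.Nat.Properties as ℕP
import Data.Nat.Divisibility as ℕD
import Data.Integer.Properties as ℤP
import Data.Integer.Divisibility.Signed as Signed
import Data.Rational as ℚ
import Data.Rational.Properties as ℚP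
import Data.Rational.Unnormalised.Properties as ℚᵘP

sign : ℕ → ℤ
sign m = -[1+ 0 ] ^ m

∣sign∣≡1 : ∀ m → ∣ sign m ∣ ≡ 1
∣sign∣≡1 ℕ.zero    = refl
∣sign∣≡1 (suc m) = trans (ℤP.abs-* -[1+ 0 ] (sign m)) (cong (1 ℕ.*_) (∣sign∣≡1 m))

-- Denominator of the continued fraction: the recursion started from (1, 0).
-- For a nonempty list it is the continuant of the tail (see denom-cons).
denom : List ℤ → ℤ
denom = contAux (+ 1) (+ 0)

contAux-linear : ∀ a b qs → contAux a b qs ≡ a * denom qs + b * continuant qs
contAux-linear a b []       = start a b
  where
  start : ∀ a b → b ≡ a * + 0 + b * + 1
  start = solve-∀
contAux-linear a b (q ∷ qs) = begin
  contAux b (q * b + a) qs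
    ≡⟨ contAux-linear b (q * b + a) qs ⟩
  b * X + (q * b + a) * P
    ≡⟨ regroup a b q X P ⟩
  a * (+ 0 * X + (q * + 0 + + 1) * P) + b * (+ 1 * X + (q * + 1 + + 0) * P)
    ≡⟨ sym (cong₂ (λ u v → a * u + b * v)
             (contAux-linear (+ 0) (q * + 0 + + 1) qs)
             (contAux-linear (+ 1) (q * + 1 + + 0) qs)) ⟩
  a * denom (q ∷ qs) + b * continuant (q ∷ qs) ∎
  where
  open ≡-Reasoning
  X P : ℤ
  X = denom qs
  P = continuant qs
  regroup : ∀ a b q x p → b * x + (q * b + a) * p
                        ≡ a * (+ 0 * x + (q * + 0 + + 1) * p) + b * (+ 1 * x + (q * + 1 + + 0) * p)
  regroup = solve-∀

denom-cons : ∀ q qs → denom (q ∷ qs) ≡ continuant qs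
denom-cons q qs = cong (λ c → contAux (+ 0) (c + + 1) qs) (ℤP.*-zeroʳ q)

continuant-cons : ∀ q qs → continuant (q ∷ qs) ≡ q * continuant qs + denom qs
continuant-cons q qs =
  trans (contAux-linear (+ 1) (q * + 1 + + 0) qs) (simplify q (denom qs) (continuant qs))
  where
  simplify : ∀ q x p → + 1 * x + (q * + 1 + + 0) * p ≡ q * p + x
  simplify = solve-∀

contAuxPrev : ℤ → ℤ → List ℤ → ℤ
contAuxPrev a b []       = a
contAuxPrev a b (q ∷ qs) = contAuxPrev b (q * b + a) qs

contAux-init : ∀ a b q qs → contAux a b (init (q ∷ qs)) ≡ contAuxPrev a b (q ∷ qs)
contAux-init a b q []       = refl
contAux-init a b q (r ∷ rs) = contAux-init b (q * b + a) r rs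

contAux-det : ∀ a b c d qs →
  contAuxPrev a b qs * contAux c d qs - contAux a b qs * contAuxPrev c d qs
    ≡ sign (length qs) * (a * d - b * c)
contAux-det a b c d []       = start a b c d
  where
  start : ∀ a b c d → a * d - b * c ≡ + 1 * (a * d - b * c)
  start = solve-∀
contAux-det a b c d (q ∷ qs) =
  trans (contAux-det b (q * b + a) d (q * d + c) qs) (flip a b c d q (sign (length qs)))
  where
  flip : ∀ a b c d q s → s * (b * (q * d + c) - (q * b + a) * d) ≡ (-[1+ 0 ] * s) * (a * d - b * c)
  flip = solve-∀

-- The previous numerator [q_0..q_{m-2}] and previous denominator [q_1..q_{m-2}].
prevNumer prevDenom : List ℤ → ℤ
prevNumer = contAuxPrev (+ 0) (+ 1)
prevDenom = contAuxPrev (+ 1) (+ 0)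

convergent-det : ∀ qs →
  prevNumer qs * denom qs + sign (length qs) ≡ continuant qs * prevDenom qs
convergent-det qs = begin
  I * X + s                        ≡⟨ expand I X P N s ⟩
  (I * X - P * N) + s + P * N      ≡⟨ cong (λ t → t + s + P * N) (contAux-det (+ 0) (+ 1) (+ 1) (+ 0) qs) ⟩
  s * (+ 0 * + 0 - + 1 * + 1) + s + P * N ≡⟨ cancel s (P * N) ⟩
  P * N                            ∎
  where
  open ≡-Reasoning
  I X P N s : ℤ
  I = prevNumer qs
  X = denom qs
  P = continuant qs
  N = prevDenom qs
  s = sign (length qs)
  expand : ∀ i x p n s → i * x + s ≡ (i * x - p * n) + s + p * n
  expand = solve-∀
  cancel : ∀ s t → s * (+ 0 * + 0 - + 1 * + 1) + s + t ≡ t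
  cancel = solve-∀

-- Numerator and denominator of a continued fraction have no common factor,
-- since every common divisor divides the sign (-1)^m.
continuant-denom-coprime : ∀ qs → Coprime ∣ continuant qs ∣ ∣ denom qs ∣
continuant-denom-coprime qs {k} (k∣P , k∣X) =
  ℕD.∣1⇒≡1 (subst (k ℕD.∣_) (∣sign∣≡1 (length qs)) (Signed.∣⇒∣ᵤ k∣sign))
  where
  k∣sign : + k Signed.∣ sign (length qs)
  k∣sign = Signed.∣m+n∣m⇒∣n
    (subst (+ k Signed.∣_) (sym (convergent-det qs))
      (Signed.∣m⇒∣m*n (prevDenom qs) (Signed.∣ᵤ⇒∣ {i = continuant qs} k∣P)))
    (Signed.∣n⇒∣m*n (prevNumer qs) (Signed.∣ᵤ⇒∣ {i = denom qs} k∣X))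

reduced-fraction-unique : ∀ {a b c d} → Coprime (suc a) (suc b) → Coprime (suc c) (suc d) →
  + suc a * + suc d ≡ + suc c * + suc b → a ≡ c × b ≡ d
reduced-fraction-unique {a} {b} {c} {d} ab cd cross =
  ℤP.+[1+-injective (cong ℚ.ℚ.numerator same) , cong ℚ.ℚ.denominator-1 same
  where
  same : ℚ.mkℚ (+ suc a) b ab ≡ ℚ.mkℚ (+ suc c) d cd
  same = ℚP.≃⇒≡ (ℚ.*≡* cross)

cfValue-fraction : ∀ q qs → All (+ 0 <_) (q ∷ qs) →
  Σ ℕ λ n → Σ ℕ λ d →
    continuant (q ∷ qs) ≡ + suc n × denom (q ∷ qs) ≡ + suc d × cfValue (q ∷ qs) ≡ mkℚᵘ (+ suc n) d
cfValue-fraction q@(+ suc k) [] (+<+ _ ∷ []) =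
  k , 0 , trans (ℤP.+-identityʳ (q * + 1)) (ℤP.*-identityʳ q) , denom-cons q [] , refl
cfValue-fraction q@(+ suc k) (r ∷ rs) (+<+ _ ∷ pos) with cfValue-fraction r rs pos
... | n , d , numer≡ , denom≡ , value≡ rewrite value≡ =
  _ , _ , numer-step , denom-step , refl
  where
  numer-step : continuant (q ∷ r ∷ rs) ≡ q * + suc n + + suc d * + 1
  numer-step = begin
    continuant (q ∷ r ∷ rs)                 ≡⟨ continuant-cons q (r ∷ rs) ⟩
    q * continuant (r ∷ rs) + denom (r ∷ rs) ≡⟨ cong₂ (λ u v → q * u + v) numer≡ denom≡ ⟩
    q * + suc n + + suc d                    ≡⟨ cong (λ t → q * + suc n + t) (sym (ℤP.*-identityʳ (+ suc d))) ⟩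
    q * + suc n + + suc d * + 1              ∎
    where open ≡-Reasoning
  denom-step : denom (q ∷ r ∷ rs) ≡ + suc (n ℕ.+ 0)
  denom-step = trans (denom-cons q (r ∷ rs)) (trans numer≡ (cong (λ t → + suc t) (sym (ℕP.+-identityʳ n))))

denom-quadratic : ∀ q qs → let L = q ∷ qs ; x = denom L in
  x * x + anticontinuant L * x + sign (length L) ≡ continuant L * prevDenom L
denom-quadratic q qs = begin
  x * x + anticontinuant L * x + s ≡⟨ cong (λ a → x * x + a * x + s) anticontinuant≡ ⟩
  x * x + (I - x) * x + s          ≡⟨ collapse x I s ⟩
  I * x + s                        ≡⟨ convergent-det L ⟩
  continuant L * prevDenom L       ∎
  where
  open ≡-Reasoning
  L : List ℤ
  L = q ∷ qs
  x I s : ℤ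
  x = denom L
  I = prevNumer L
  s = sign (length L)
  anticontinuant≡ : anticontinuant L ≡ I - x
  anticontinuant≡ = cong₂ _-_ (contAux-init (+ 0) (+ 1) q qs) (sym (denom-cons q qs))
  collapse : ∀ x i s → x * x + (i - x) * x + s ≡ i * x + s
  collapse = solve-∀

continuant-root : ∀ q qs → let L = q ∷ qs ; x = denom L in
  continuant L ∣ x * x + anticontinuant L * x + sign (length L)
continuant-root q qs = subst (continuant (q ∷ qs) ∣_) (sym (denom-quadratic q qs))
  (Signed.∣⇒∣ᵤ (Signed.∣m⇒∣m*n {m = continuant (q ∷ qs)} (prevDenom (q ∷ qs)) Signed.∣-refl))

-- The lowest-terms fraction α/β equals continuant/denom, so α and β are
-- the continuant and the denominator.  The empty list has value 0 ≠ α/β.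
proposition3 : (α β : ℕ) → Coprime (suc α) (suc β) →
               (qs : List ℤ) → All (λ q → + 0 < q) qs →
               (+ suc α) / suc β ≃ cfValue qs →
               + suc α ∣ ((+ suc β) * (+ suc β) + anticontinuant qs * (+ suc β) + (-[1+ 0 ] ^ length qs))
proposition3 α β αβ-coprime []       _   (*≡* ())
proposition3 α β αβ-coprime (q ∷ qs) pos α/β≃cf with cfValue-fraction q qs pos
... | n , d , numer≡ , denom≡ , value≡ =
  subst₂ (λ p x → p ∣ x * x + anticontinuant (q ∷ qs) * x + sign (length (q ∷ qs)))
    (trans numer≡ (cong (λ t → + suc t) (sym α≡n)))
    (trans denom≡ (cong (λ t → + suc t) (sym β≡d)))
    (continuant-root q qs)
  where
  nd-coprime : Coprime (suc n) (suc d)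
  nd-coprime = subst₂ (λ u v → Coprime ∣ u ∣ ∣ v ∣) numer≡ denom≡ (continuant-denom-coprime (q ∷ qs))
  cross : + suc α * + suc d ≡ + suc n * + suc β
  cross = ℚᵘP.drop-*≡* (subst ((+ suc α) / suc β ≃_) value≡ α/β≃cf)
  lowest-terms : α ≡ n × β ≡ d
  lowest-terms = reduced-fraction-unique αβ-coprime nd-coprime cross
  α≡n : α ≡ n
  α≡n = proj₁ lowest-terms
  β≡d : β ≡ d
  β≡d = proj₂ lowest-terms
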